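{- For any set $\Gamma$ of FOML formulas and any FOML formula $\varphi$, if $\Gamma^{\mathrm{FOL}} \models_{\mathrm{FOL}} \varphi^{\mathrm{FOL}}$ then $\Gamma \models \varphi$.
   Context: FOML (first-order modal logic) setting: there are disjoint denumerable sets $\mathcal{X}$ of rigid variables, $\mathcal{V}$ of flexible variables, and $\mathcal{O}$ of operator symbols with arities. Expressions are given by $e ::= x \mid v \mid op(e,\ldots,e) \mid e=e \mid \mathrm{FALSE} \mid e \Rightarrow e \mid \forall x: e \mid \nabla e$ with $x\in\mathcal{X}$, $v\in\mathcal{V}$, $op\in\mathcal{O}$ (no distinction between terms and formulas; no quantification over flexible variables). A Kripke model is $\mathcal{M}=(\mathcal{I},\xi,\mathcal{W},R,\zeta,\nabla_{\mathcal{M}})$: $\mathcal{I}$ is a first-order interpretation with universe $|\mathcal{I}|$ containing distinct values $\mathsf{tt},\mathsf{ff}$ and rigid interpretations $\mathcal{I}(op):|\mathcal{I}|^n\to|\mathcal{I}|$; $\xi:\mathcal{X}\to|\mathcal{I}|$; $\mathcal{W}$ a nonempty set of states with accessibility relation $R\subseteq\mathcal{W}\times\mathcal{W}$; $\zeta:\mathcal{V}\times\mathcal{W}\to|\mathcal{I}|$; and $\nabla_{\mathcal{M}}:2^{|\mathcal{I}|}\to|\mathcal{I}|$ with $\nabla_{\mathcal{M}}(S)=\mathsf{tt}$ iff $S\subseteq\{\mathsf{tt}\}$. The value $[\![e]\!]^{\mathcal{M}}_w$ is defined in the standard way ($x\mapsto\xi(x)$, $v\mapsto\zeta(v,w)$,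 operators applied pointwise, $=$ gives $\mathsf{tt}/\mathsf{ff}$, $\varphi\Rightarrow\psi$ is $\mathsf{tt}$ iff $[\![\varphi]\!]_w\neq\mathsf{tt}$ or $[\![\psi]\!]_w=\mathsf{tt}$, $\forall$ ranges over all re-valuations of $x$ in the constant domain, and $[\![\nabla\varphi]\!]_w=\nabla_{\mathcal{M}}(\{[\![\varphi]\!]_{w'}:(w,w')\in R\})$). $\mathcal{M},w\models\varphi$ means $[\![\varphi]\!]^{\mathcal{M}}_w=\mathsf{tt}$. Consequence: $\Gamma\models\varphi$ iff for every $\mathcal{M}$, if $\mathcal{M},w\models\psi$ for all $\psi\in\Gamma$ and all $w\in\mathcal{W}$, then $\mathcal{M},w\models\varphi$ for all $w\in\mathcal{W}$. $\models_{\mathrm{FOL}}$ is ordinary first-order consequence (flexible variables treated as ordinary first-order variables). The first-order abstraction (coalescing) $e^{\mathrm{FOL}}$ is $(e^{\varepsilon})^{\mathrm{FOL}}$, where for a list $\vec{y}$ of rigid variables: $x$ and $v$ map to themselves; $op(e_1,\ldots,e_n)$, $e_1=e_2$, $\mathrm{FALSE}$, $e_1\Rightarrow e_2$ are translated homomorphically; $(\forall x:e)^{\vec y}$ maps to $\forall x: (e^{x,\vec y})^{\mathrm{FOL}}$; and $(\nabla e)^{\vec y}$ maps to $[\lambda \vec z:\nabla e](\vec z)$, where $\vec z$ is the subsequence of variables of $\vec y$ occurring free in $e$ and $[\lambda \vec z:\nabla e]$ is a fresh operator symbol, with $\alpha$-equivalent $\lambda$-expressions yielding the same symbol. $\Gamma^{\mathrm{FOL}}=\{\psi^{\mathrm{FOL}}:\psi\in\Gamma\}$.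 -}

module Defs where

open import Level using (0ℓ)
open import Data.Nat.Base using (ℕ; zero; suc; _+_; _∸_; _≡ᵇ_; _<ᵇ_)
open import Data.Bool.Base using (Bool; true; false; _∨_; if_then_else_)
open import Data.List.Base using (List; []; _∷_; length; upTo; filterᵇ)
open import Data.Vec.Base as Vec using (Vec; []; _∷_)
open import Data.Product.Base using (Σ; _×_; _,_)
open import Data.Sum.Base using (_⊎_; inj₁; inj₂)
open import Data.Empty using (⊥)
open import Relation.Nullary.Decidable.Core using (Dec; yes; no)
open import Relation.Binary.PropositionalEquality.Core using (_≡_; _≢_)
open import Function.Bundles using (_⇔_)
open import Axiom.ExcludedMiddle using (ExcludedMiddle)

-- Conventions
--  * Rigid variables are represented nameless (de Bruijn indices ℕ):
--    `rv i` refers to the i-th enclosing ∀ (index 0 = innermost), and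
--    indices beyond the enclosing binders are the free rigid variables.
--    Syntax is thus taken up to α-equivalence.
--  * Flexible variables are named by ℕ (never bound).
--  * Operator symbols: an arbitrary set Op with arity function ar.
--  * The meta-theory is classical: semantics is defined relative to an
--    excluded-middle oracle `lem`, which the theorem assumes.

module FOL (Sym : Set) (arity : Sym → ℕ) where

  data Term : Set where
    rv    : ℕ → Term
    fv    : ℕ → Term
    op    : (s : Sym) → Vec Term (arity s) → Term
    _≐_   : Term → Term → Term
    FALSE : Term
    _⇒_   : Term → Term → Term
    ∀'    : Term → Term

  record Structure : Set₁ where
    field
      D      : Set
      tt ff  : D
      tt≢ff  : tt ≢ ff
      I      : (s : Sym) → Vec D (arity s) → D

  ext : {D : Set} → D → (ℕ → D) → (ℕ → D)
  ext d ρ zero    = d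
  ext d ρ (suc i) = ρ i

  module Eval (lem : ExcludedMiddle 0ℓ) (𝓘 : Structure) where
    open Structure 𝓘

    toD : {P : Set} → Dec P → D
    toD (yes _) = tt
    toD (no _)  = ff

    mutual
      ⟦_⟧ : Term → (ℕ → D) → (ℕ → D) → D
      ⟦ rv i ⟧ ξ ζ = ξ i
      ⟦ fv v ⟧ ξ ζ = ζ v
      ⟦ op s es ⟧ ξ ζ = I s (⟦ es ⟧* ξ ζ)
      ⟦ a ≐ b ⟧ ξ ζ = toD (lem {⟦ a ⟧ ξ ζ ≡ ⟦ b ⟧ ξ ζ})
      ⟦ FALSE ⟧ ξ ζ = ff
      ⟦ a ⇒ b ⟧ ξ ζ = toD (lem {(⟦ a ⟧ ξ ζ ≡ tt → ⊥) ⊎ ⟦ b ⟧ ξ ζ ≡ tt})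
      ⟦ ∀' e ⟧ ξ ζ = toD (lem {(d : D) → ⟦ e ⟧ (ext d ξ) ζ ≡ tt})

      ⟦_⟧* : ∀ {n} → Vec Term n → (ℕ → D) → (ℕ → D) → Vec D n
      ⟦ [] ⟧* ξ ζ = []
      ⟦ e ∷ es ⟧* ξ ζ = ⟦ e ⟧ ξ ζ ∷ ⟦ es ⟧* ξ ζ

  _⊨FOL_ : (lem : ExcludedMiddle 0ℓ) → (Term → Set) → Term → Set₁
  _⊨FOL_ lem Γ φ =
    (𝓘 : Structure) (ξ : ℕ → Structure.D 𝓘) (ζ : ℕ → Structure.D 𝓘) →
    ((ψ : Term) → Γ ψ → Eval.⟦_⟧ lem 𝓘 ψ ξ ζ ≡ Structure.tt 𝓘) →
    Eval.⟦_⟧ lem 𝓘 φ ξ ζ ≡ Structure.tt 𝓘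

module FOML (Op : Set) (ar : Op → ℕ) where

  data Expr : Set where
    rv    : ℕ → Expr
    fv    : ℕ → Expr
    op    : (o : Op) → Vec Expr (ar o) → Expr
    _≐_   : Expr → Expr → Expr
    FALSE : Expr
    _⇒_   : Expr → Expr → Expr
    ∀'    : Expr → Expr
    ∇     : Expr → Expr

  record Model : Set₁ where
    field
      D      : Set
      tt ff  : D
      tt≢ff  : tt ≢ ff
      I      : (o : Op) → Vec D (ar o) → D
      ξ      : ℕ → D
      W      : Set
      w₀     : W                              -- W is nonempty
      R      : W → W → Set
      ζ      : ℕ → W → D
      -- ∇_M : 2^|I| → |I|, subsets represented as predicates, so ∇_M
      -- must respect extensional equality of subsets.
      ∇M     : (D → Set) → D
      ∇M-ext : (S T : D → Set) → ((d : D) → S d ⇔ T d) → ∇M S ≡ ∇M T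
      ∇M-tt  : (S : D → Set) → ∇M S ≡ tt ⇔ ((d : D) → S d → d ≡ tt)

  ext : {D : Set} → D → (ℕ → D) → (ℕ → D)
  ext d ρ zero    = d
  ext d ρ (suc i) = ρ i

  module Eval (lem : ExcludedMiddle 0ℓ) (M : Model) where
    open Model M

    toD : {P : Set} → Dec P → D
    toD (yes _) = tt
    toD (no _)  = ff

    mutual
      ⟦_⟧ : Expr → (ℕ → D) → W → D
      ⟦ rv i ⟧ ρ w = ρ i
      ⟦ fv v ⟧ ρ w = ζ v w
      ⟦ op o es ⟧ ρ w = I o (⟦ es ⟧* ρ w)
      ⟦ a ≐ b ⟧ ρ w = toD (lem {⟦ a ⟧ ρ w ≡ ⟦ b ⟧ ρ w})
      ⟦ FALSE ⟧ ρ w = ff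
      ⟦ a ⇒ b ⟧ ρ w = toD (lem {(⟦ a ⟧ ρ w ≡ tt → ⊥) ⊎ ⟦ b ⟧ ρ w ≡ tt})
      ⟦ ∀' e ⟧ ρ w = toD (lem {(d : D) → ⟦ e ⟧ (ext d ρ) w ≡ tt})
      ⟦ ∇ e ⟧ ρ w = ∇M (λ d → Σ W (λ w' → R w w' × ⟦ e ⟧ ρ w' ≡ d))

      ⟦_⟧* : ∀ {n} → Vec Expr n → (ℕ → D) → W → Vec D n
      ⟦ [] ⟧* ρ w = []
      ⟦ e ∷ es ⟧* ρ w = ⟦ e ⟧ ρ w ∷ ⟦ es ⟧* ρ w

    _,_⊨_ : Model → W → Expr → Set
    _ , w ⊨ φ = ⟦ φ ⟧ ξ w ≡ tt

  _⊨_ : (lem : ExcludedMiddle 0ℓ) → (Expr → Set) → Expr → Set₁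
  _⊨_ lem Γ φ =
    (M : Model) →
    ((ψ : Expr) → Γ ψ → (w : Model.W M) → Eval._,_⊨_ lem M M w ψ) →
    (w : Model.W M) → Eval._,_⊨_ lem M M w φ

  mutual
    occurs : ℕ → Expr → Bool
    occurs i (rv j) = i ≡ᵇ j
    occurs i (fv v) = false
    occurs i (op o es) = occurs* i es
    occurs i (a ≐ b) = occurs i a ∨ occurs i b
    occurs i FALSE = false
    occurs i (a ⇒ b) = occurs i a ∨ occurs i b
    occurs i (∀' e) = occurs (suc i) e
    occurs i (∇ e) = occurs i e

    occurs* : ∀ {n} → ℕ → Vec Expr n → Bool
    occurs* i [] = false
    occurs* i (e ∷ es) = occurs i e ∨ occurs* i es

  lift : (ℕ → ℕ) → (ℕ → ℕ)
  lift ρ zero    = zero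
  lift ρ (suc i) = suc (ρ i)

  mutual
    rename : (ℕ → ℕ) → Expr → Expr
    rename ρ (rv i) = rv (ρ i)
    rename ρ (fv v) = fv v
    rename ρ (op o es) = op o (rename* ρ es)
    rename ρ (a ≐ b) = rename ρ a ≐ rename ρ b
    rename ρ FALSE = FALSE
    rename ρ (a ⇒ b) = rename ρ a ⇒ rename ρ b
    rename ρ (∀' e) = ∀' (rename (lift ρ) e)
    rename ρ (∇ e) = ∇ (rename ρ e)

    rename* : ∀ {n} → (ℕ → ℕ) → Vec Expr n → Vec Expr n
    rename* ρ [] = []
    rename* ρ (e ∷ es) = rename ρ e ∷ rename* ρ es

  pos : List ℕ → ℕ → ℕ
  pos [] i = zero
  pos (j ∷ js) i = if i ≡ᵇ j then zero else suc (pos js i)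

  -- The fresh symbol [λ z⃗ : ∇ e] is represented canonically (hence
  -- α-equivalent λ-expressions give the same symbol) as the pair
  -- (m , e') where m = |z⃗| is its arity and e' is the nameless body:
  -- z_j ↦ index j-1, free (global) rigid variable with top-level index n
  -- ↦ index m + n.
  LamSym : Set
  LamSym = Σ ℕ (λ _ → Expr)

  Sym : Set
  Sym = Op ⊎ LamSym

  arity : Sym → ℕ
  arity (inj₁ o) = ar o
  arity (inj₂ (m , _)) = m

  open FOL Sym arity public
    using (Term; Structure; _⊨FOL_)
    renaming (rv to rvᶠ; fv to fvᶠ; op to opᶠ; _≐_ to _≐ᶠ_; FALSE to FALSEᶠ;
              _⇒_ to _⇒ᶠ_; ∀' to ∀ᶠ)

  -- renaming used to close the body of ∇ e at binder depth k
  compact : ℕ → List ℕ → ℕ → ℕ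
  compact k zs i = if i <ᵇ k then pos zs i else length zs + (i ∸ k)

  -- e^{y⃗} followed by ^FOL, where y⃗ = the k enclosing ∀-binders
  -- (indices 0 … k-1, innermost first)
  mutual
    coal : ℕ → Expr → Term
    coal k (rv i) = rvᶠ i
    coal k (fv v) = fvᶠ v
    coal k (op o es) = opᶠ (inj₁ o) (coal* k es)
    coal k (a ≐ b) = coal k a ≐ᶠ coal k b
    coal k FALSE = FALSEᶠ
    coal k (a ⇒ b) = coal k a ⇒ᶠ coal k b
    coal k (∀' e) = ∀ᶠ (coal (suc k) e)
    coal k (∇ e) =
      let zs = filterᵇ (λ i → occurs i e) (upTo k) in
      opᶠ (inj₂ (length zs , rename (compact k zs) e))
          (Vec.map rvᶠ (Vec.fromList zs))

    coal* : ∀ {n} → ℕ → Vec Expr n → Vec Term n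
    coal* k [] = []
    coal* k (e ∷ es) = coal k e ∷ coal* k es

  _ᶠᵒˡ : Expr → Term
  e ᶠᵒˡ = coal zero e

  _ᶠᵒˡˢ : (Expr → Set) → (Term → Set)
  (Γ ᶠᵒˡˢ) χ = Σ Expr (λ ψ → Γ ψ × ψ ᶠᵒˡ ≡ χ)

module Submission where

-- Given a Kripke model M and a world w, we read off a first-order
-- structure 𝓘 M w with the same universe: original operators keep their
-- meaning, and a fresh symbol [λ z⃗ : ∇ e] of arity m is interpreted as
-- the modal value of ∇ e at w, the z⃗ taking the m arguments and the free
-- rigid variables of e keeping their values under ξ.  The central fact
-- ('coalescing-sound') is that for every FOML expression e
--     ⟦ e^FOL ⟧ in 𝓘 M w (rigid ξ, flexible ζ(·,w))  =  ⟦ e ⟧ in M at w.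
-- It is proved by induction on e, generalised over the binder depth k of
-- the translation.  The ∇ case rests on the renaming lemma
-- ('rename-sound'): evaluating a renamed expression equals evaluating
-- the original under the composed valuation, provided they agree on the
-- variables that occur free.  The theorem then follows by instantiating
-- the first-order hypothesis at 𝓘 M w, for every world w.

open import Defs
open import Level using (0ℓ)
open import Data.Nat.Base using (ℕ; zero; suc; _+_; _∸_; _≡ᵇ_; _<ᵇ_; _<_)
open import Data.Nat.Properties using (≡ᵇ⇒≡; ≡⇒≡ᵇ; <ᵇ⇒<; <⇒<ᵇ; ≮⇒≥; m+[n∸m]≡n)
open import Data.Bool.Base using (true; false; T; _∨_)
open import Data.Bool.Properties using (T-∨; T?)
open import Data.List.Base using (List; []; _∷_; length; upTo; filterᵇ)
open import Data.List.Membership.Propositional using (_∈_)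
open import Data.List.Membership.Propositional.Properties using (∈-upTo⁺; ∈-filter⁺)
open import Data.List.Relation.Unary.Any using (here; there)
open import Data.Vec.Base as Vec using (Vec; []; _∷_)
open import Data.Product.Base using (Σ; _×_; _,_)
open import Data.Sum.Base using (_⊎_; inj₁; inj₂)
open import Data.Empty using (⊥; ⊥-elim)
open import Relation.Nullary.Decidable.Core using (Dec; yes; no)
open import Relation.Binary.PropositionalEquality
open import Function.Bundles using (_⇔_; mk⇔; Equivalence)
open import Axiom.ExcludedMiddle using (ExcludedMiddle)

T-∨ˡ : ∀ {a b} → T a → T (a ∨ b)
T-∨ˡ p = Equivalence.from T-∨ (inj₁ p)

T-∨ʳ : ∀ {a b} → T b → T (a ∨ b)
T-∨ʳ p = Equivalence.from T-∨ (inj₂ p)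

module Coalescing (Op : Set) (ar : Op → ℕ) where
  open FOML Op ar
  module F = FOL Sym arity

  -- 'prepend ds σ' is the valuation that sends index j < n to the j-th
  -- entry of ds and index n + j to σ j; it is how the arguments of a
  -- fresh symbol [λ z⃗ : ∇ e] are bound in front of the other rigid
  -- variables.
  prepend : {D : Set} {n : ℕ} → Vec D n → (ℕ → D) → ℕ → D
  prepend []       σ j       = σ j
  prepend (d ∷ ds) σ zero    = d
  prepend (d ∷ ds) σ (suc j) = prepend ds σ j

  module _ {D : Set} (ρ σ : ℕ → D) where

    prepend-pos : (zs : List ℕ) (i : ℕ) → i ∈ zs →
                  prepend (Vec.map ρ (Vec.fromList zs)) σ (pos zs i) ≡ ρ i
    prepend-pos (j ∷ zs) i i∈ with i ≡ᵇ j in eq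
    ... | true = cong ρ (sym (≡ᵇ⇒≡ i j (subst T (sym eq) _)))
    ... | false with i∈
    ...   | here refl  = ⊥-elim (subst T eq (≡⇒≡ᵇ i i refl))
    ...   | there i∈zs = prepend-pos zs i i∈zs

    prepend-beyond : (zs : List ℕ) (n : ℕ) →
                     prepend (Vec.map ρ (Vec.fromList zs)) σ (length zs + n) ≡ σ n
    prepend-beyond []       n = refl
    prepend-beyond (j ∷ zs) n = prepend-beyond zs n

    compact-sound : (k : ℕ) (zs : List ℕ) → (∀ j → ρ (k + j) ≡ σ j) →
                    (i : ℕ) → (i < k → i ∈ zs) →
                    prepend (Vec.map ρ (Vec.fromList zs)) σ (compact k zs i) ≡ ρ i
    compact-sound k zs global i listed with i <ᵇ k in eq
    ... | true  = prepend-pos zs i (listed (<ᵇ⇒< i k (subst T (sym eq) _)))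
    ... | false = begin
      prepend (Vec.map ρ (Vec.fromList zs)) σ (length zs + (i ∸ k)) ≡⟨ prepend-beyond zs (i ∸ k) ⟩
      σ (i ∸ k)                                                     ≡⟨ sym (global (i ∸ k)) ⟩
      ρ (k + (i ∸ k))                                               ≡⟨ cong ρ (m+[n∸m]≡n {k} {i} k≤i) ⟩
      ρ i                                                           ∎
      where
        open ≡-Reasoning
        k≤i = ≮⇒≥ (λ i<k → subst T eq (<⇒<ᵇ i<k))

  variables-sound : (lem : ExcludedMiddle 0ℓ) (𝓘 : Structure) →
                    let open Structure 𝓘 in
                    (ρ ζ : ℕ → D) (zs : List ℕ) →
                    F.Eval.⟦_⟧* lem 𝓘 (Vec.map rvᶠ (Vec.fromList zs)) ρ ζ
                      ≡ Vec.map ρ (Vec.fromList zs)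
  variables-sound lem 𝓘 ρ ζ []       = refl
  variables-sound lem 𝓘 ρ ζ (j ∷ zs) = cong (ρ j ∷_) (variables-sound lem 𝓘 ρ ζ zs)

  module Semantics (lem : ExcludedMiddle 0ℓ) (M : Model) where
    open Model M
    open Eval lem M using (⟦_⟧; ⟦_⟧*; toD)

    -- The semantic clauses of M as operations on values; the evaluation
    -- of ≐, ⇒, ∀' and ∇ unfolds definitionally to these.
    _≐ᴹ_ : D → D → D
    a ≐ᴹ b = toD (lem {a ≡ b})

    _⇒ᴹ_ : D → D → D
    a ⇒ᴹ b = toD (lem {(a ≡ tt → ⊥) ⊎ b ≡ tt})

    ∀ᴹ : (D → D) → D
    ∀ᴹ f = toD (lem {(d : D) → f d ≡ tt})

    ∇ᴹ : W → (W → D) → D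
    ∇ᴹ w f = ∇M (λ d → Σ W (λ w' → R w w' × f w' ≡ d))

    toD-cong : {P Q : Set} (p : Dec P) (q : Dec Q) → P ⇔ Q → toD p ≡ toD q
    toD-cong (yes p) (yes q) P⇔Q = refl
    toD-cong (yes p) (no ¬q) P⇔Q = ⊥-elim (¬q (Equivalence.to P⇔Q p))
    toD-cong (no ¬p) (yes q) P⇔Q = ⊥-elim (¬p (Equivalence.from P⇔Q q))
    toD-cong (no ¬p) (no ¬q) P⇔Q = refl

    -- Quantifier and modal clauses respect pointwise equality of their
    -- bodies (we have no function extensionality, so this is a lemma).
    ∀ᴹ-cong : (f g : D → D) → (∀ d → f d ≡ g d) → ∀ᴹ f ≡ ∀ᴹ g
    ∀ᴹ-cong f g f≗g = toD-cong lem lem (mk⇔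
      (λ all-f d → trans (sym (f≗g d)) (all-f d))
      (λ all-g d → trans (f≗g d) (all-g d)))

    ∇ᴹ-cong : (w : W) (f g : W → D) → (∀ w' → f w' ≡ g w') → ∇ᴹ w f ≡ ∇ᴹ w g
    ∇ᴹ-cong w f g f≗g = ∇M-ext _ _ (λ d → mk⇔
      (λ { (w' , r , fw'≡d) → w' , r , trans (sym (f≗g w')) fw'≡d })
      (λ { (w' , r , gw'≡d) → w' , r , trans (f≗g w') gw'≡d }))

    mutual
      rename-sound : (f : ℕ → ℕ) (e : Expr) (σ ρ : ℕ → D) →
                     (∀ i → T (occurs i e) → σ (f i) ≡ ρ i) →
                     (w : W) → ⟦ rename f e ⟧ σ w ≡ ⟦ e ⟧ ρ w
      rename-sound f (rv i)    σ ρ agree w = agree i (≡⇒≡ᵇ i i refl)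
      rename-sound f (fv v)    σ ρ agree w = refl
      rename-sound f (op o es) σ ρ agree w = cong (I o) (rename-sound* f es σ ρ agree w)
      rename-sound f (a ≐ b)   σ ρ agree w = cong₂ _≐ᴹ_
        (rename-sound f a σ ρ (λ i o → agree i (T-∨ˡ o)) w)
        (rename-sound f b σ ρ (λ i o → agree i (T-∨ʳ {occurs i a} o)) w)
      rename-sound f FALSE     σ ρ agree w = refl
      rename-sound f (a ⇒ b)   σ ρ agree w = cong₂ _⇒ᴹ_
        (rename-sound f a σ ρ (λ i o → agree i (T-∨ˡ o)) w)
        (rename-sound f b σ ρ (λ i o → agree i (T-∨ʳ {occurs i a} o)) w)
      rename-sound f (∀' e)    σ ρ agree w = ∀ᴹ-cong _ _ (λ d →
        rename-sound (lift f) e (ext d σ) (ext d ρ) (agree-under d) w)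
        where
          agree-under : (d : D) → ∀ i → T (occurs i e) → ext d σ (lift f i) ≡ ext d ρ i
          agree-under d zero    o = refl
          agree-under d (suc i) o = agree i o
      rename-sound f (∇ e)     σ ρ agree w =
        ∇ᴹ-cong w _ _ (rename-sound f e σ ρ agree)

      rename-sound* : ∀ {n} (f : ℕ → ℕ) (es : Vec Expr n) (σ ρ : ℕ → D) →
                      (∀ i → T (occurs* i es) → σ (f i) ≡ ρ i) →
                      (w : W) → ⟦ rename* f es ⟧* σ w ≡ ⟦ es ⟧* ρ w
      rename-sound* f []       σ ρ agree w = refl
      rename-sound* f (e ∷ es) σ ρ agree w = cong₂ _∷_
        (rename-sound f e σ ρ (λ i o → agree i (T-∨ˡ o)) w)
        (rename-sound* f es σ ρ (λ i o → agree i (T-∨ʳ {occurs i e} o)) w)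

    induced : W → Structure
    induced w = record
      { D = D ; tt = tt ; ff = ff ; tt≢ff = tt≢ff
      ; I = λ { (inj₁ o)       ds → I o ds
              ; (inj₂ (m , e)) ds → ⟦ ∇ e ⟧ (prepend ds ξ) w } }

    module AtWorld (w : W) where
      module G = F.Eval lem (induced w)

      ζ-at : ℕ → D
      ζ-at v = ζ v w

      toD-agree : {P : Set} (p : Dec P) → G.toD p ≡ toD p
      toD-agree (yes _) = refl
      toD-agree (no _)  = refl

      mutual
        coalescing-sound : (k : ℕ) (e : Expr) (ρf ρm : ℕ → D) →
                           (∀ i → ρf i ≡ ρm i) → (∀ j → ρm (k + j) ≡ ξ j) →
                           G.⟦ coal k e ⟧ ρf ζ-at ≡ ⟦ e ⟧ ρm w
        coalescing-sound k (rv i)    ρf ρm agree global = agree i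
        coalescing-sound k (fv v)    ρf ρm agree global = refl
        coalescing-sound k (op o es) ρf ρm agree global =
          cong (I o) (coalescing-sound* k es ρf ρm agree global)
        coalescing-sound k (a ≐ b)   ρf ρm agree global = trans (toD-agree lem)
          (cong₂ _≐ᴹ_ (coalescing-sound k a ρf ρm agree global)
                      (coalescing-sound k b ρf ρm agree global))
        coalescing-sound k FALSE     ρf ρm agree global = refl
        coalescing-sound k (a ⇒ b)   ρf ρm agree global = trans (toD-agree lem)
          (cong₂ _⇒ᴹ_ (coalescing-sound k a ρf ρm agree global)
                      (coalescing-sound k b ρf ρm agree global))
        coalescing-sound k (∀' e)    ρf ρm agree global = trans (toD-agree lem)
          (∀ᴹ-cong _ _ (λ d → coalescing-sound (suc k) e (F.ext d ρf) (ext d ρm)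
                                (agree-under d) global))
          where
            agree-under : (d : D) → ∀ i → F.ext d ρf i ≡ ext d ρm i
            agree-under d zero    = refl
            agree-under d (suc i) = agree i
        coalescing-sound k (∇ e)     ρf ρm agree global = begin
          ⟦ ∇ body ⟧ (prepend (G.⟦ Vec.map rvᶠ (Vec.fromList zs) ⟧* ρf ζ-at) ξ) w
            ≡⟨ cong (λ ds → ⟦ ∇ body ⟧ (prepend ds ξ) w)
                    (variables-sound lem (induced w) ρf ζ-at zs) ⟩
          ⟦ ∇ body ⟧ (prepend (Vec.map ρf (Vec.fromList zs)) ξ) w
            ≡⟨ rename-sound (compact k zs) (∇ e) _ ρm closes w ⟩
          ⟦ ∇ e ⟧ ρm w
            ∎
          where
            open ≡-Reasoning
            zs   = filterᵇ (λ i → occurs i e) (upTo k)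
            body = rename (compact k zs) e
            -- zs lists every bound variable occurring in e, so the closing
            -- renaming recovers the value of each free variable of e.
            closes : ∀ i → T (occurs i e) →
                     prepend (Vec.map ρf (Vec.fromList zs)) ξ (compact k zs i) ≡ ρm i
            closes i occ = trans
              (compact-sound ρf ξ k zs (λ j → trans (agree (k + j)) (global j)) i
                 (λ i<k → ∈-filter⁺ (λ i → T? (occurs i e)) (∈-upTo⁺ i<k) occ))
              (agree i)

        coalescing-sound* : ∀ {n} (k : ℕ) (es : Vec Expr n) (ρf ρm : ℕ → D) →
                            (∀ i → ρf i ≡ ρm i) → (∀ j → ρm (k + j) ≡ ξ j) →
                            G.⟦ coal* k es ⟧* ρf ζ-at ≡ ⟦ es ⟧* ρm w
        coalescing-sound* k []       ρf ρm agree global = refl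
        coalescing-sound* k (e ∷ es) ρf ρm agree global = cong₂ _∷_
          (coalescing-sound k e ρf ρm agree global)
          (coalescing-sound* k es ρf ρm agree global)

      abstraction-sound : (e : Expr) → G.⟦ e ᶠᵒˡ ⟧ ξ ζ-at ≡ ⟦ e ⟧ ξ w
      abstraction-sound e = coalescing-sound zero e ξ ξ (λ _ → refl) (λ _ → refl)

theorem1 : (Op : Set) (ar : Op → ℕ) (lem : ExcludedMiddle 0ℓ) →
    let open FOML Op ar in
    (Γ : Expr → Set) (φ : Expr) →
    _⊨FOL_ lem (Γ ᶠᵒˡˢ) (φ ᶠᵒˡ) → _⊨_ lem Γ φ
theorem1 Op ar lem Γ φ fol-consequence M Γ-valid w =
  trans (sym (abstraction-sound φ))
        (fol-consequence (induced w) ξ ζ-at Γᶠᵒˡ-true)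
  where
    open FOML Op ar
    open Model M using (ξ)
    open Coalescing Op ar
    open Semantics lem M
    open AtWorld w
    Γᶠᵒˡ-true : (χ : Term) → (Γ ᶠᵒˡˢ) χ → G.⟦ χ ⟧ ξ ζ-at ≡ Model.tt M
    Γᶠᵒˡ-true χ (ψ , ψ∈Γ , refl) = trans (abstraction-sound ψ) (Γ-valid ψ ψ∈Γ w)
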